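{- Let $q$ be a prime power, let $r$ be an integer with $2\le r\le q$, let $a\in\mathbb{F}_{q^2}^*$, and let $f=aX+X^{r(q-1)+1}\in\mathbb{F}_{q^2}[X]$. Assume that $f$ is a permutation polynomial of $\mathbb{F}_{q^2}$. Then $\gcd(r,q+1)>1$ and $(-a)^{(q+1)/\gcd(r,q+1)}\ne 1$. In particular, if $r$ is a prime, then $q+1\equiv 0\pmod r$ and $(-a)^{(q+1)/r}\ne 1$.
   Context: A polynomial $f\in\mathbb{F}_{Q}[X]$ is a permutation polynomial of $\mathbb{F}_Q$ if the map $x\mapsto f(x)$ is a bijection of $\mathbb{F}_Q$. -}

module Defs where

open import Level using (Level; suc; _⊔_)
open import Data.Nat as ℕ using (ℕ; _≤_; NonZero; ≢-nonZero)
open import Data.Nat.Primality using (Prime; prime⇒nonZero)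
open import Data.Nat.GCD using (gcd; gcd[m,n]≢0)
open import Data.Nat.DivMod using (_/_)
open import Data.Fin using (Fin)
open import Data.Product using (Σ; ∃; ∃-syntax; _×_; _,_)
open import Data.Sum using (inj₂)
open import Relation.Nullary using (¬_)
open import Relation.Binary.PropositionalEquality using (_≡_)
open import Algebra.Bundles using (CommutativeRing; Semiring)
import Algebra.Definitions.RawSemiring as RS

IsPrimePower : ℕ → Set
IsPrimePower q = ∃[ p ] ∃[ k ] (Prime p × 1 ≤ k × q ≡ p ℕ.^ k)

record Field (c ℓ : Level) : Set (suc (c ⊔ ℓ)) where
  field
    commutativeRing : CommutativeRing c ℓ
  open CommutativeRing commutativeRing public
  field
    0≉1     : ¬ (0# ≈ 1#)
    inverse : ∀ x → ¬ (x ≈ 0#) → ∃[ y ] (x * y ≈ 1#)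

  open RS (Semiring.rawSemiring semiring) public using (_^_)

module _ {c ℓ} (F : Field c ℓ) where
  open Field F

  HasCardinality : ℕ → Set (c ⊔ ℓ)
  HasCardinality N =
    Σ (Fin N → Carrier) λ e →
      (∀ i j → e i ≈ e j → i ≡ j) × (∀ x → ∃[ i ] (e i ≈ x))

  -- g permutes F: x ↦ g x is a bijection of the carrier (w.r.t. _≈_),
  -- assuming g respects _≈_ (automatic for polynomial functions).
  IsPermutation : (Carrier → Carrier) → Set (c ⊔ ℓ)
  IsPermutation g =
    (∀ x y → g x ≈ g y → x ≈ y) × (∀ y → ∃[ x ] (g x ≈ y))

  polyF : (a : Carrier) (q r : ℕ) → Carrier → Carrier
  polyF a q r x = a * x + x ^ (r ℕ.* (q ℕ.∸ 1) ℕ.+ 1)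

quotGcd : ℕ → ℕ → ℕ
quotGcd r q = _/_ (ℕ.suc q) (gcd r (ℕ.suc q))
  {{≢-nonZero (gcd[m,n]≢0 r (ℕ.suc q) (inj₂ λ ()))}}

quotPrime : (r q : ℕ) → Prime r → ℕ
quotPrime r q pr = _/_ (ℕ.suc q) r {{prime⇒nonZero pr}}

module Submission where

-- Put n = q - 1, so N′ = |F| - 1 = n(q+1).  Everything rests on the power sums
-- S(m) = ∑_{x∈F} x^m, which vanish unless N′ ∣ m > 0, where S(m) = -1.
--  * gcd(r, q+1) ≠ 1: otherwise 0 = S(n) = ∑_x f(x)^n since f permutes F; expanding f(x)^n
--    binomially, exactly one exponent n(1 + j·r) is divisible by N′, which leaves
--    C(n, j₀)·a^{n-j₀} = 0, impossible in characteristic p because p ∤ C(p^e - 1, j₀).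
--  * (-a)^m ≠ 1 for m = (q+1)/gcd(r,q+1): otherwise -a = x^{rn} for some x (a geometric-sum
--    count), and then f(x) = 0 = f(0) with x ≠ 0.
-- The file proves, in order: the arithmetic facts (binomial coefficients mod p, the congruence
-- 1 + j·r ≡ 0 mod q+1, the order (q+1)/gcd(r,q+1)); field algebra (zero divisors, geometric
-- sums, characteristic, root bound); finite fields (reindexing sums, Fermat, power sums, R-th
-- roots, binomial expansion); and finally the two claims and the theorem.

open import Defs
open import Level using (_⊔_)
open import Data.Nat as ℕ using (ℕ; zero; suc; _≤_; _<_; _∸_; z≤n; s≤s; NonZero)
import Data.Nat.Properties as ℕ
open import Data.Nat.Divisibility using (_∣_; divides; m%n≡0⇒n∣m; *-monoʳ-∣; *-cancelˡ-∣; >⇒∤)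
open import Data.Nat.DivMod using (_%_; _/_; m%n<n; m≡m%n+[m/n]*n; /-congʳ)
open import Data.Nat.GCD using (gcd; gcd[m,n]≢0; gcd[m,n]∣m; gcd[m,n]∣n; module Bézout)
open import Data.Nat.Coprimality using (Coprime; coprime-Bézout; gcd≡1⇒coprime)
open import Data.Nat.Primality using (Prime; prime⇒irreducible; prime⇒nonZero)
open import Data.Nat.Combinatorics using (_C_)
open import Data.Nat.Tactic.RingSolver using (solve-∀)
open import Data.Fin as Fin using (Fin; toℕ; fromℕ<; punchIn; punchOut)
open import Data.Fin.Properties
  using (punchIn-punchOut; punchInᵢ≢i; punchIn-injective; any?; toℕ<n; toℕ-fromℕ<; toℕ-injective; toℕ≤pred[n])
open import Data.Fin.Permutation using (permutation)
open import Data.Vec.Functional using (removeAt)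
open import Data.List using (List; []; _∷_; length; replicate; tabulate)
open import Data.List.Properties using (length-tabulate; length-replicate)
open import Data.List.Relation.Unary.All as All using (All; []; _∷_)
open import Data.List.Relation.Unary.AllPairs using (AllPairs; []; _∷_)
import Data.List.Relation.Unary.All.Properties as AllProperties
import Data.List.Relation.Unary.AllPairs.Properties as AllPairsProperties
open import Data.Unit.Polymorphic using (⊤)
open import Data.Product using (∃; _,_; proj₁; proj₂) renaming (_×_ to _∧_)
open import Data.Sum using (inj₁; inj₂)
open import Data.Empty using (⊥-elim)
open import Function using (_∘_)
open import Relation.Nullary using (¬_; Dec; yes; no; contradiction; ¬?)
open import Relation.Nullary.Decidable using (decidable-stable)
open import Relation.Binary.PropositionalEquality as ≡ using (_≡_; _≢_)
open import Algebra.Bundles using (Semiring; CommutativeMonoid)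
import Algebra.Properties.CommutativeMonoid.Sum as MonoidSum
import Algebra.Properties.CommutativeSemigroup as CommSemigroupProperties
import Algebra.Properties.Group as GroupProperties
import Algebra.Properties.Ring as RingProperties
import Algebra.Properties.Semiring.Sum as SemiringSum
import Algebra.Properties.Semiring.Mult as SemiringMult
import Algebra.Properties.Semiring.Exp as SemiringExp
import Algebra.Properties.CommutativeSemiring.Exp as CommSemiringExp
import Algebra.Properties.CommutativeSemiring.Binomial as CommSemiringBinomial
import Algebra.Solver.Ring.NaturalCoefficients.Default as Solver

module Arithmetic where

  open import Data.Nat
  open import Data.Nat.Properties
  open import Data.Nat.Divisibility
  open import Data.Nat.DivMod using (_%_; _/_; m≡m%n+[m/n]*n; m%n<n; m*[n/m]≡n; m≥n⇒m/n>0)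
  open import Data.Nat.GCD using (gcd; gcd[m,n]∣m; gcd[m,n]∣n; module Bézout)
  open import Data.Nat.Coprimality using (Coprime; coprime-Bézout; coprime-divisor; coprime-/gcd)
    renaming (sym to coprime-sym)
  open import Data.Nat.Primality using (Prime; euclidsLemma; prime⇒irreducible; prime⇒nonZero; prime⇒nonTrivial)
  open import Data.Nat.Combinatorics using (_C_; nC1≡n; nCk+nC[k+1]≡[n+1]C[k+1])
  open import Data.Nat.Tactic.RingSolver using (solve-∀)
  open import Data.Product using (∃; _×_; _,_; proj₁; proj₂)
  open import Data.Sum using (inj₁; inj₂)
  open import Relation.Nullary using (¬_; yes; no; contradiction)
  open import Relation.Binary.PropositionalEquality

  C-absorption : ∀ n k → suc k * (suc n C suc k) ≡ suc n * (n C k)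
  C-absorption zero    zero    = refl
  C-absorption zero    (suc k) = *-zeroʳ (suc (suc k))
  C-absorption (suc n) zero    =
    trans (*-identityˡ _) (trans (nC1≡n (suc (suc n))) (sym (*-identityʳ _)))
  C-absorption (suc n) (suc k) = begin
    (2 + k) * ((2 + n) C (2 + k)) ≡⟨ cong ((2 + k) *_) (nCk+nC[k+1]≡[n+1]C[k+1] (suc n) (suc k)) ⟨
    (2 + k) * (A + B)             ≡⟨ expand (1 + k) A B ⟩
    A + (1 + k) * A + (2 + k) * B ≡⟨ cong₂ (λ u v → A + u + v) (C-absorption n k) (C-absorption n (suc k)) ⟩
    A + (1 + n) * X + (1 + n) * Y ≡⟨ collect (1 + n) A X Y ⟩
    A + (1 + n) * (X + Y)         ≡⟨ cong (λ u → A + (1 + n) * u) (nCk+nC[k+1]≡[n+1]C[k+1] n k) ⟩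
    (2 + n) * A                   ∎
    where
    open ≡-Reasoning
    A = suc n C suc k
    B = suc n C suc (suc k)
    X = n C k
    Y = n C suc k
    expand : ∀ k A B → suc k * (A + B) ≡ A + k * A + suc k * B
    expand = solve-∀
    collect : ∀ m A X Y → A + m * X + m * Y ≡ A + m * (X + Y)
    collect = solve-∀

  module _ {p : ℕ} (p-prime : Prime p) where

    private instance
      p-nonZero : NonZero p
      p-nonZero = prime⇒nonZero p-prime

    prime-power-∣-cancel : ∀ e {j c} → p ^ e ∣ j * c → ¬ p ∣ c → p ^ e ∣ j
    prime-power-∣-cancel zero    {j}     _   _   = 1∣ j
    prime-power-∣-cancel (suc e) {j} {c} p^e∣ p∤c
      with euclidsLemma j c p-prime (∣-trans (m∣m*n (p ^ e)) p^e∣)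
    ... | inj₂ p∣c = contradiction p∣c p∤c
    ... | inj₁ (divides j′ refl) =
      subst (p * p ^ e ∣_) (*-comm p j′) (*-monoʳ-∣ p (prime-power-∣-cancel e p^e∣j′c p∤c))
      where
      p^e∣j′c : p ^ e ∣ j′ * c
      p^e∣j′c = *-cancelˡ-∣ p (subst (p * p ^ e ∣_) (regroup j′ p c) p^e∣)
        where
        regroup : ∀ j′ p c → j′ * p * c ≡ p * (j′ * c)
        regroup = solve-∀

    -- p divides C(p^e, j+1) for j+1 < p^e, since (j+1)·C(p^e, j+1) = p^e·C(p^e-1, j).
    prime-∣-C : ∀ e n j → p ^ e ≡ suc n → j < n → p ∣ suc n C suc j
    prime-∣-C e n j p^e≡ j<n with p ∣? (suc n C suc j)
    ... | yes p∣C = p∣C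
    ... | no  p∤C = contradiction (∣⇒≤ p^e∣1+j) (<⇒≱ (subst (suc j <_) (sym p^e≡) (s≤s j<n)))
      where
      p^e∣1+j : p ^ e ∣ suc j
      p^e∣1+j = prime-power-∣-cancel e (subst (_∣ suc j * (suc n C suc j)) (sym p^e≡)
        (divides (n C j) (trans (C-absorption n j) (*-comm (suc n) (n C j))))) p∤C

    -- Hence p divides no C(p^e - 1, j): by Pascal's rule C(n,j) + C(n,j+1) ≡ 0 (mod p),
    -- descending from C(n,0) = 1.
    prime-∤-C : ∀ e n j → p ^ e ≡ suc n → j ≤ n → ¬ p ∣ n C j
    prime-∤-C e n zero    _    _     p∣1 = <⇒≱ (nonTrivial⇒n>1 p {{prime⇒nonTrivial p-prime}}) (∣⇒≤ p∣1)
    prime-∤-C e n (suc j) p^e≡ 1+j≤n p∣C = prime-∤-C e n j p^e≡ (<⇒≤ 1+j≤n)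
      (∣m+n∣m⇒∣n (subst (p ∣_) pascal (prime-∣-C e n j p^e≡ 1+j≤n)) p∣C)
      where
      pascal : suc n C suc j ≡ n C suc j + n C j
      pascal = trans (sym (nCk+nC[k+1]≡[n+1]C[k+1] n j)) (+-comm (n C j) (n C suc j))

  congruence-solvable : ∀ {q r} → Coprime r (suc q) → ∃ λ j → suc q ∣ suc (j * r)
  congruence-solvable {q} {r} r⊥Q with coprime-Bézout r⊥Q
  ... | Bézout.+- x y eq = q * x , divides (1 + q * y) (begin
    suc (q * x * r)          ≡⟨ cong suc (*-assoc q x r) ⟩
    suc (q * (x * r))        ≡⟨ cong (λ u → suc (q * u)) eq ⟨
    suc (q * (1 + y * suc q)) ≡⟨ factor q y ⟩
    (1 + q * y) * suc q      ∎)
    where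
    open ≡-Reasoning
    factor : ∀ q y → suc (q * (1 + y * suc q)) ≡ (1 + q * y) * suc q
    factor = solve-∀
  ... | Bézout.-+ x y eq = x , divides y eq

  congruence-mod : ∀ {Q r} j .{{_ : NonZero Q}} → Q ∣ suc (j * r) → Q ∣ suc (j % Q * r)
  congruence-mod {Q} {r} j Q∣ = ∣m+n∣m⇒∣n (subst (Q ∣_) split Q∣) (n∣m*n*o (j / Q) r)
    where
    split : suc (j * r) ≡ j / Q * Q * r + suc (j % Q * r)
    split = begin
      suc (j * r)                      ≡⟨ cong (λ u → suc (u * r)) (m≡m%n+[m/n]*n j Q) ⟩
      suc ((j % Q + j / Q * Q) * r)    ≡⟨ shuffle (j % Q) (j / Q * Q) r ⟩
      j / Q * Q * r + suc (j % Q * r)  ∎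
      where
      open ≡-Reasoning
      shuffle : ∀ a b r → suc ((a + b) * r) ≡ b * r + suc (a * r)
      shuffle = solve-∀

  congruence-unique : ∀ {Q r a b} → Coprime Q r → a ≤ b → b < Q →
                      Q ∣ suc (a * r) → Q ∣ suc (b * r) → a ≡ b
  congruence-unique {Q} {r} {a} {b} Q⊥r a≤b b<Q Q∣a Q∣b with m≤n⇒∃[o]m+o≡n a≤b
  ... | zero  , refl = sym (+-identityʳ a)
  ... | suc d , refl = contradiction (coprime-divisor Q⊥r (∣m+n∣m⇒∣n (subst (Q ∣_) split Q∣b) Q∣a))
                                     (>⇒∤ (≤-<-trans (m≤n+m (suc d) a) b<Q))
    where
    split : suc ((a + suc d) * r) ≡ suc (a * r) + r * suc d
    split = shuffle a (suc d) r
      where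
      shuffle : ∀ a d r → suc ((a + d) * r) ≡ suc (a * r) + r * d
      shuffle = solve-∀

  -- For 2 ≤ r ≤ q, the residue j = q is never a solution modulo q+1:
  -- (q+1)·r = (1 + q·r) + (r-1) and 0 < r-1 < q+1.
  congruence-not-q : ∀ {q r} → 2 ≤ r → r ≤ q → ¬ suc q ∣ suc (q * r)
  congruence-not-q {r = suc zero} (s≤s ())
  congruence-not-q {q} {suc r′@(suc _)} _ r≤q Q∣ =
    >⇒∤ (s≤s (≤-trans (n≤1+n r′) r≤q)) (∣m+n∣m⇒∣n (subst (suc q ∣_) split (n∣m*n (suc r′))) Q∣)
    where
    split : suc r′ * suc q ≡ suc (q * suc r′) + r′
    split = shuffle q r′
      where
      shuffle : ∀ q r′ → suc r′ * suc q ≡ suc (q * suc r′) + r′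
      shuffle = solve-∀

  unique-solution : ∀ {q r} → 2 ≤ r → r ≤ q → Coprime r (suc q) →
    ∃ λ j₀ → j₀ < q × suc q ∣ suc (j₀ * r) × (∀ j → j < q → suc q ∣ suc (j * r) → j ≡ j₀)
  unique-solution {q} {r} 2≤r r≤q r⊥Q = j₀ , j₀<q , Q∣j₀ , unique
    where
    j = proj₁ (congruence-solvable r⊥Q)
    j₀ = j % suc q
    Q∣j₀ : suc q ∣ suc (j₀ * r)
    Q∣j₀ = congruence-mod j (proj₂ (congruence-solvable r⊥Q))
    j₀<q : j₀ < q
    j₀<q = ≤∧≢⇒< (≤-pred (m%n<n j (suc q))) λ j₀≡q →
      congruence-not-q 2≤r r≤q (subst (λ i → suc q ∣ suc (i * r)) j₀≡q Q∣j₀)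
    unique : ∀ j → j < q → suc q ∣ suc (j * r) → j ≡ j₀
    unique j j<q Q∣j with ≤-total j j₀
    ... | inj₁ j≤j₀ = congruence-unique (coprime-sym r⊥Q) j≤j₀ (m<n⇒m<1+n j₀<q) Q∣j Q∣j₀
    ... | inj₂ j₀≤j = sym (congruence-unique (coprime-sym r⊥Q) j₀≤j (m<n⇒m<1+n j<q) Q∣j₀ Q∣j)

  module _ (r Q : ℕ) .{{_ : NonZero (gcd r Q)}} where

    private
      d = gcd r Q
      r′ = r / d
      d*r′≡r : d * r′ ≡ r
      d*r′≡r = m*[n/m]≡n (gcd[m,n]∣m r Q)
      d*m≡Q : d * (Q / d) ≡ Q
      d*m≡Q = m*[n/m]≡n (gcd[m,n]∣n r Q)

    ∣-r*quotient : Q ∣ r * (Q / gcd r Q)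
    ∣-r*quotient = divides r′ (begin
      r * m           ≡⟨ cong (_* m) d*r′≡r ⟨
      d * r′ * m      ≡⟨ swap d r′ m ⟩
      r′ * (d * m)    ≡⟨ cong (r′ *_) d*m≡Q ⟩
      r′ * Q          ∎)
      where
      open ≡-Reasoning
      m = Q / d
      swap : ∀ d r′ m → d * r′ * m ≡ r′ * (d * m)
      swap = solve-∀

    quotient-least : ∀ i → 0 < i → i < Q / gcd r Q → ¬ Q ∣ r * i
    quotient-least i@(suc _) _ i<m Q∣ri = >⇒∤ i<m (coprime-divisor (coprime-sym (coprime-/gcd r Q)) m∣r′i)
      where
      m∣r′i : Q / d ∣ r′ * i
      m∣r′i = *-cancelˡ-∣ d (subst₂ _∣_ (sym d*m≡Q) (trans (cong (_* i) (sym d*r′≡r)) (*-assoc d r′ i)) Q∣ri)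

    quotient-positive : ∀ .{{_ : NonZero Q}} → 0 < Q / gcd r Q
    quotient-positive = m≥n⇒m/n>0 (∣⇒≤ (gcd[m,n]∣n r Q))

  prime∤⇒coprime : ∀ {p n} → Prime p → ¬ p ∣ n → Coprime p n
  prime∤⇒coprime p-prime p∤n (d∣p , d∣n) with prime⇒irreducible p-prime d∣p
  ... | inj₁ d≡1 = d≡1
  ... | inj₂ refl = contradiction d∣n p∤n

  -- For the exponents of f = aX + X^(r·n+1): with k ≤ n, the monomial (X^(rn+1))^k·X^(n-k)
  -- has degree n·(1 + k·r).
  binomial-exponent : ∀ n r k → k ≤ n → (r * n + 1) * k + (n ∸ k) ≡ n * suc (k * r)
  binomial-exponent n r k k≤n = begin
    (r * n + 1) * k + (n ∸ k)    ≡⟨ split-off n r k (n ∸ k) ⟩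
    n * (k * r) + (k + (n ∸ k))  ≡⟨ cong (n * (k * r) +_) (m+[n∸m]≡n k≤n) ⟩
    n * (k * r) + n              ≡⟨ +-comm (n * (k * r)) n ⟩
    n + n * (k * r)              ≡⟨ *-suc n (k * r) ⟨
    n * suc (k * r)              ∎
    where
    open ≡-Reasoning
    split-off : ∀ n r k d → (r * n + 1) * k + d ≡ n * (k * r) + (k + d)
    split-off = solve-∀

open Arithmetic

module FieldProperties {c ℓ} (F : Field c ℓ) where

  open Field F
  open import Algebra.Definitions.RawSemiring (Semiring.rawSemiring semiring) using (product)
  open import Relation.Binary.Reasoning.Setoid setoid
  open GroupProperties +-group using (x∙y⁻¹≈ε⇒x≈y; ∙-cancelʳ)
  open RingProperties ring using (-1*x≈-x)
  open SemiringSum semiring using (sum; *-distribˡ-sum; sum-remove; sum-cong-≋; sum-replicate-zero)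
  open SemiringMult semiring using (_×_; ×1-homo-*)
  open SemiringExp semiring using (^-congˡ)
  open Solver commutativeSemiring using (solve; _:+_; _:*_; _:=_; con)

  1≉0 : ¬ 1# ≈ 0#
  1≉0 1≈0 = 0≉1 (sym 1≈0)

  *-cancelˡ-nonzero : ∀ {x y z} → ¬ x ≈ 0# → x * y ≈ x * z → y ≈ z
  *-cancelˡ-nonzero {x} {y} {z} x≉0 xy≈xz = begin
    y               ≈⟨ *-identityˡ y ⟨
    1# * y          ≈⟨ *-congʳ x⁻¹x≈1 ⟨
    (x⁻¹ * x) * y   ≈⟨ *-assoc x⁻¹ x y ⟩
    x⁻¹ * (x * y)   ≈⟨ *-congˡ xy≈xz ⟩
    x⁻¹ * (x * z)   ≈⟨ *-assoc x⁻¹ x z ⟨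
    (x⁻¹ * x) * z   ≈⟨ *-congʳ x⁻¹x≈1 ⟩
    1# * z          ≈⟨ *-identityˡ z ⟩
    z               ∎
    where
    x⁻¹ = proj₁ (inverse x x≉0)
    x⁻¹x≈1 : x⁻¹ * x ≈ 1#
    x⁻¹x≈1 = trans (*-comm x⁻¹ x) (proj₂ (inverse x x≉0))

  no-zero-divisors : ∀ {x y} → ¬ x ≈ 0# → x * y ≈ 0# → y ≈ 0#
  no-zero-divisors {x} x≉0 xy≈0 = *-cancelˡ-nonzero x≉0 (trans xy≈0 (sym (zeroʳ x)))

  *-nonzero : ∀ {x y} → ¬ x ≈ 0# → ¬ y ≈ 0# → ¬ x * y ≈ 0#
  *-nonzero x≉0 y≉0 xy≈0 = y≉0 (no-zero-divisors x≉0 xy≈0)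

  ^-nonzero : ∀ {x} n → ¬ x ≈ 0# → ¬ x ^ n ≈ 0#
  ^-nonzero zero    _   = 1≉0
  ^-nonzero (suc n) x≉0 = *-nonzero x≉0 (^-nonzero n x≉0)

  -‿nonzero : ∀ {x} → ¬ x ≈ 0# → ¬ - x ≈ 0#
  -‿nonzero {x} x≉0 -x≈0 = x≉0 (begin
    x          ≈⟨ +-identityʳ x ⟨
    x + 0#     ≈⟨ +-congˡ -x≈0 ⟨
    x + - x    ≈⟨ -‿inverseʳ x ⟩
    0#         ∎)

  0^-positive : ∀ {n} → 0 ℕ.< n → 0# ^ n ≈ 0#
  0^-positive {suc n} _ = zeroˡ (0# ^ n)

  1^n≈1 : ∀ n → 1# ^ n ≈ 1#
  1^n≈1 zero    = refl
  1^n≈1 (suc n) = trans (*-identityˡ _) (1^n≈1 n)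

  product-nonzero : ∀ {n} (t : Fin n → Carrier) → (∀ i → ¬ t i ≈ 0#) → ¬ product t ≈ 0#
  product-nonzero {zero}  t _     = 1≉0
  product-nonzero {suc n} t t≉0 = *-nonzero (t≉0 Fin.zero) (product-nonzero (t ∘ Fin.suc) (t≉0 ∘ Fin.suc))

  fixed-by-non-one⇒0 : ∀ {z y} → ¬ z ≈ 1# → z * y ≈ y → y ≈ 0#
  fixed-by-non-one⇒0 {z} {y} z≉1 zy≈y = no-zero-divisors z-1≉0 (begin
    (z + - 1#) * y      ≈⟨ distribʳ y z (- 1#) ⟩
    z * y + - 1# * y    ≈⟨ +-cong zy≈y (-1*x≈-x y) ⟩
    y + - y             ≈⟨ -‿inverseʳ y ⟩
    0#                  ∎)
    where
    z-1≉0 : ¬ z + - 1# ≈ 0#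
    z-1≉0 z-1≈0 = z≉1 (x∙y⁻¹≈ε⇒x≈y z 1# z-1≈0)

  geometricSum : ℕ → Carrier → Carrier
  geometricSum m z = sum {m} (λ i → z ^ toℕ i)

  geometricSum-shift : ∀ m z → z * geometricSum m z + 1# ≈ geometricSum m z + z ^ m
  geometricSum-shift zero    z = trans (+-congʳ (zeroʳ z)) (trans (+-identityˡ 1#) (sym (+-identityˡ 1#)))
  geometricSum-shift (suc m) z = begin
    z * (1# + G′) + 1#          ≈⟨ +-congʳ (*-congˡ (+-congˡ (*-distribˡ-sum {m} z (λ i → z ^ toℕ i)))) ⟨
    z * (1# + z * G) + 1#       ≈⟨ solve 2 (λ z G → z :* (con 1 :+ z :* G) :+ con 1 := z :* (z :* G :+ con 1) :+ con 1) refl z G ⟩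
    z * (z * G + 1#) + 1#       ≈⟨ +-congʳ (*-congˡ (geometricSum-shift m z)) ⟩
    z * (G + z ^ m) + 1#        ≈⟨ solve 3 (λ z G w → z :* (G :+ w) :+ con 1 := (con 1 :+ z :* G) :+ z :* w) refl z G (z ^ m) ⟩
    (1# + z * G) + z * z ^ m    ≈⟨ +-congʳ (+-congˡ (*-distribˡ-sum {m} z (λ i → z ^ toℕ i))) ⟩
    (1# + G′) + z * z ^ m       ∎
    where
    G = geometricSum m z
    G′ = sum {m} (λ i → z * z ^ toℕ i)

  geometricSum-cong : ∀ m {z w} → z ≈ w → geometricSum m z ≈ geometricSum m w
  geometricSum-cong m z≈w = sum-cong-≋ {m} λ i → ^-congˡ (toℕ i) z≈w

  geometricSum-at-0 : ∀ m → geometricSum (suc m) 0# ≈ 1#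
  geometricSum-at-0 m = trans (+-congˡ (trans (sum-cong-≋ {m} λ i → zeroˡ _) (sum-replicate-zero m))) (+-identityʳ 1#)

  geometricSum-vanishes : ∀ m {z} → z ^ m ≈ 1# → ¬ z ≈ 1# → geometricSum m z ≈ 0#
  geometricSum-vanishes m {z} z^m≈1 z≉1 = fixed-by-non-one⇒0 z≉1
    (∙-cancelʳ 1# _ _ (trans (geometricSum-shift m z) (+-congˡ z^m≈1)))

  ×1-multiple : ∀ {d} k → d × 1# ≈ 0# → (k ℕ.* d) × 1# ≈ 0#
  ×1-multiple k d≈0 = trans (×1-homo-* k _) (trans (*-congˡ d≈0) (zeroʳ _))

  one-plus-vanishing : ∀ {d m} k → d × 1# ≈ 0# → 1 ℕ.+ k ℕ.* d ≡ m → m × 1# ≈ 0# → 1# ≈ 0#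
  one-plus-vanishing k d≈0 ≡.refl m≈0 = begin
    1#                    ≈⟨ +-identityʳ 1# ⟨
    1# + 0#               ≈⟨ +-congˡ (×1-multiple k d≈0) ⟨
    (1 ℕ.+ k ℕ.* _) × 1#  ≈⟨ m≈0 ⟩
    0#                    ∎

  ×1-^ : ∀ p e → (p ℕ.^ e) × 1# ≈ (p × 1#) ^ e
  ×1-^ p zero    = +-identityʳ 1#
  ×1-^ p (suc e) = trans (×1-homo-* p (p ℕ.^ e)) (*-congˡ (×1-^ p e))

  -- If the prime p vanishes in F, then no natural number prime to p does:
  -- a Bézout identity 1 + y·C = x·p (or 1 + x·p = y·C) would give 1 = 0.
  coprime-to-char-nonzero : ∀ {p C} → Prime p → p × 1# ≈ 0# → ¬ p ∣ C → ¬ C × 1# ≈ 0#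
  coprime-to-char-nonzero {p} {C} p-prime p≈0 p∤C C≈0
    with coprime-Bézout (prime∤⇒coprime p-prime p∤C)
  ... | Bézout.+- x y eq = 1≉0 (one-plus-vanishing y C≈0 eq (×1-multiple x p≈0))
  ... | Bézout.-+ x y eq = 1≉0 (one-plus-vanishing x p≈0 eq (×1-multiple y C≈0))

  sum-single : ∀ {n} (t : Fin (suc n) → Carrier) i → (∀ j → j ≢ i → t j ≈ 0#) → sum t ≈ t i
  sum-single {n} t i others = begin
    sum t                     ≈⟨ sum-remove t ⟩
    t i + sum (removeAt t i)  ≈⟨ +-congˡ (sum-cong-≋ λ j → others _ (punchInᵢ≢i i j)) ⟩
    t i + sum {n} (λ _ → 0#)  ≈⟨ +-congˡ (sum-replicate-zero n) ⟩
    t i + 0#                  ≈⟨ +-identityʳ (t i) ⟩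
    t i                       ∎

  -- Monic polynomials: the list a₀ ∷ … ∷ a_{d-1} represents a₀ + a₁X + … + a_{d-1}X^{d-1} + X^d.
  evalMonic : List Carrier → Carrier → Carrier
  evalMonic []       x = 1#
  evalMonic (a ∷ as) x = a + x * evalMonic as x

  -- Synthetic division by X - z, giving a monic quotient of degree one less.
  divideBy : Carrier → List Carrier → List Carrier
  divideBy z []           = []
  divideBy z (a ∷ [])     = []
  divideBy z (a ∷ b ∷ as) = evalMonic (b ∷ as) z ∷ divideBy z (b ∷ as)

  divideBy-length : ∀ z a as → length (divideBy z (a ∷ as)) ≡ length as
  divideBy-length z a []       = ≡.refl
  divideBy-length z a (b ∷ as) = ≡.cong suc (divideBy-length z b as)

  x≈[x-z]+z : ∀ x z → x ≈ (x + - z) + z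
  x≈[x-z]+z x z = sym (trans (+-assoc x (- z) z) (trans (+-congˡ (-‿inverseˡ z)) (+-identityʳ x)))

  divideBy-spec : ∀ z a as x →
    evalMonic (a ∷ as) x ≈ (x + - z) * evalMonic (divideBy z (a ∷ as)) x + evalMonic (a ∷ as) z
  divideBy-spec z a [] x = begin
    a + x * 1#        ≈⟨ +-congˡ (*-congʳ x≈u+z) ⟩
    a + (u + z) * 1#  ≈⟨ solve 3 (λ a u z → a :+ (u :+ z) :* con 1 := u :* con 1 :+ (a :+ z :* con 1)) refl a u z ⟩
    u * 1# + (a + z * 1#) ∎
    where
    u = x + - z
    x≈u+z = x≈[x-z]+z x z
  divideBy-spec z a (b ∷ as) x = begin
    a + x * evalMonic (b ∷ as) x  ≈⟨ +-congˡ (*-cong x≈u+z (divideBy-spec z b as x)) ⟩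
    a + (u + z) * (u * D + w)
      ≈⟨ solve 5 (λ a u z D w → a :+ (u :+ z) :* (u :* D :+ w) := u :* (w :+ (u :+ z) :* D) :+ (a :+ z :* w))
                 refl a u z D w ⟩
    u * (w + (u + z) * D) + (a + z * w) ≈⟨ +-congʳ (*-congˡ (+-congˡ (*-congʳ x≈u+z))) ⟨
    u * (w + x * D) + (a + z * w) ∎
    where
    u = x + - z
    D = evalMonic (divideBy z (b ∷ as)) x
    w = evalMonic (b ∷ as) z
    x≈u+z = x≈[x-z]+z x z

  -- A monic polynomial of degree d has at most d distinct roots: every root other than z
  -- is a root of the quotient by X - z.
  root-bound : ∀ as zs → AllPairs (λ u v → ¬ u ≈ v) zs → All (λ z → evalMonic as z ≈ 0#) zs →
               length zs ≤ length as
  root-bound as       []       _           _            = z≤n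
  root-bound []       (z ∷ zs) _           (1≈0 ∷ _)    = ⊥-elim (1≉0 1≈0)
  root-bound (a ∷ as) (z ∷ zs) (z≉zs ∷ zs-distinct) (Pz≈0 ∷ Pzs≈0) =
    s≤s (≡.subst (length zs ≤_) (divideBy-length z a as)
      (root-bound (divideBy z (a ∷ as)) zs zs-distinct (All.zipWith root-of-quotient (z≉zs , Pzs≈0))))
    where
    root-of-quotient : ∀ {y} → ¬ z ≈ y ∧ evalMonic (a ∷ as) y ≈ 0# → evalMonic (divideBy z (a ∷ as)) y ≈ 0#
    root-of-quotient {y} (z≉y , Py≈0) = no-zero-divisors y-z≉0 (begin
      (y + - z) * evalMonic (divideBy z (a ∷ as)) y       ≈⟨ +-identityʳ _ ⟨
      (y + - z) * evalMonic (divideBy z (a ∷ as)) y + 0#  ≈⟨ +-congˡ Pz≈0 ⟨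
      (y + - z) * evalMonic (divideBy z (a ∷ as)) y + evalMonic (a ∷ as) z ≈⟨ divideBy-spec z a as y ⟨
      evalMonic (a ∷ as) y                                ≈⟨ Py≈0 ⟩
      0#                                                  ∎)
      where
      y-z≉0 : ¬ y + - z ≈ 0#
      y-z≉0 y-z≈0 = z≉y (sym (x∙y⁻¹≈ε⇒x≈y y z y-z≈0))

  X^[1+k]-1 : ℕ → List Carrier
  X^[1+k]-1 k = - 1# ∷ replicate k 0#

  evalMonic-X^[1+k]-1 : ∀ k x → evalMonic (X^[1+k]-1 k) x ≈ - 1# + x ^ suc k
  evalMonic-X^[1+k]-1 k x = +-congˡ (*-congˡ (evalMonic-X^k k))
    where
    evalMonic-X^k : ∀ k → evalMonic (replicate k 0#) x ≈ x ^ k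
    evalMonic-X^k zero    = refl
    evalMonic-X^k (suc k) = trans (+-identityˡ _) (*-congˡ (evalMonic-X^k k))

module FiniteField {c ℓ} (F : Field c ℓ) {N′ : ℕ} (card : HasCardinality F (suc N′)) where

  open Field F
  open FieldProperties F
  open import Relation.Binary.Reasoning.Setoid setoid
  open SemiringSum semiring
    using (sum; sum-cong-≋; sum-remove; ∑-distrib-+; ∑-comm; sum-replicate; sum-replicate-zero; *-distribˡ-sum; *-distribʳ-sum)
  open SemiringMult semiring using (_×_; ×-congʳ; ×-assoc-*)
  open SemiringExp semiring using (^-congˡ; ^-homo-*; ^-assocʳ)
  open CommSemiringExp commutativeSemiring using (^-distrib-*)
  module Product = MonoidSum *-commutativeMonoid
  module Binomial = CommSemiringBinomial commutativeSemiring
  open CommSemigroupProperties *-commutativeSemigroup using (x∙yz≈y∙xz)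
  open GroupProperties +-group using (identityʳ-unique; ∙-cancelʳ; inverseʳ-unique)

  element : Fin (suc N′) → Carrier
  element = proj₁ card

  element-injective : ∀ i j → element i ≈ element j → i ≡ j
  element-injective = proj₁ (proj₂ card)

  index : Carrier → Fin (suc N′)
  index x = proj₁ (proj₂ (proj₂ card) x)

  element-index : ∀ x → element (index x) ≈ x
  element-index x = proj₂ (proj₂ (proj₂ card) x)

  -- Equality in a finite field is decidable: compare positions in the enumeration.
  infix 4 _≈?_
  _≈?_ : ∀ x y → Dec (x ≈ y)
  x ≈? y with index x Fin.≟ index y
  ... | yes i≡j = yes (trans (sym (element-index x)) (trans (reflexive (≡.cong element i≡j)) (element-index y)))
  ... | no  i≢j = no λ x≈y → i≢j (element-injective _ _ (trans (element-index x) (trans x≈y (sym (element-index y)))))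

  record Enumeration {p} (P : Carrier → Set p) (n : ℕ) : Set (c ⊔ ℓ ⊔ p) where
    field
      at        : Fin n → Carrier
      injective : ∀ i j → at i ≈ at j → i ≡ j
      sound     : ∀ i → P (at i)
      position  : ∀ x → P x → Fin n
      complete  : ∀ x (Px : P x) → at (position x Px) ≈ x

  record Permutes {p} (P : Carrier → Set p) (π : Carrier → Carrier) : Set (c ⊔ ℓ ⊔ p) where
    field
      cong       : ∀ {x y} → x ≈ y → π x ≈ π y
      preserves  : ∀ {x} → P x → P (π x)
      injective  : ∀ x y → π x ≈ π y → x ≈ y
      surjective : ∀ y → P y → ∃ λ x → P x ∧ π x ≈ y

  -- Sums (in any commutative monoid) over an enumeration are invariant under bijections
  -- of the enumerated set: π induces a permutation of the positions.
  module _ {a ℓ′} (M : CommutativeMonoid a ℓ′) where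
    private
      module M = CommutativeMonoid M
      module ΣM = MonoidSum M

    reindex : ∀ {p n} {P : Carrier → Set p} (E : Enumeration P n) (g : Carrier → M.Carrier) →
              (∀ {x y} → x ≈ y → g x M.≈ g y) → ∀ {π} → Permutes P π →
              ΣM.sum (λ i → g (π (Enumeration.at E i))) M.≈ ΣM.sum (λ i → g (Enumeration.at E i))
    reindex {P = P} E g g-cong {π} π-perm =
      M.trans (ΣM.sum-cong-≋ λ i → g-cong (sym (complete (π (at i)) _)))
              (M.sym (ΣM.sum-permute (g ∘ at) (permutation σ τ σ∘τ τ∘σ)))
      where
      open Enumeration E
      open Permutes π-perm renaming (cong to π-cong; injective to π-injective)
      σ : Fin _ → Fin _
      σ i = position (π (at i)) (preserves (sound i))
      preimage : ∀ j → ∃ λ x → P x ∧ π x ≈ at j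
      preimage j = surjective (at j) (sound j)
      τ : Fin _ → Fin _
      τ j = position (proj₁ (preimage j)) (proj₁ (proj₂ (preimage j)))
      σ∘τ : ∀ j → σ (τ j) ≡ j
      σ∘τ j = injective _ _ (trans (complete _ _) (trans (π-cong (complete _ _)) (proj₂ (proj₂ (preimage j)))))
      τ∘σ : ∀ i → τ (σ i) ≡ i
      τ∘σ i = injective _ _ (trans (complete _ _)
        (π-injective _ _ (trans (proj₂ (proj₂ (preimage (σ i)))) (complete _ _))))

  everything : Enumeration {ℓ} (λ _ → ⊤) (suc N′)
  everything = record
    { at = element ; injective = element-injective ; sound = λ _ → _
    ; position = λ x _ → index x ; complete = λ x _ → element-index x }

  zeroIndex : Fin (suc N′)
  zeroIndex = index 0#

  unit : Fin N′ → Carrier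
  unit j = element (punchIn zeroIndex j)

  units : Enumeration (λ x → ¬ x ≈ 0#) N′
  units = record
    { at        = unit
    ; injective = λ i j uᵢ≈uⱼ → punchIn-injective zeroIndex i j (element-injective _ _ uᵢ≈uⱼ)
    ; sound     = λ j uⱼ≈0 → punchInᵢ≢i zeroIndex j (element-injective _ _ (trans uⱼ≈0 (sym (element-index 0#))))
    ; position  = λ x x≉0 → punchOut (index≢zeroIndex x≉0)
    ; complete  = λ x x≉0 → trans (reflexive (≡.cong element (punchIn-punchOut (index≢zeroIndex x≉0)))) (element-index x)
    }
    where
    index≢zeroIndex : ∀ {x} → ¬ x ≈ 0# → zeroIndex ≢ index x
    index≢zeroIndex {x} x≉0 eq =
      x≉0 (trans (sym (element-index x)) (trans (reflexive (≡.cong element (≡.sym eq))) (element-index 0#)))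

  sumAll : (Carrier → Carrier) → Carrier
  sumAll g = sum (λ i → g (element i))

  sumUnits : (Carrier → Carrier) → Carrier
  sumUnits g = sum (λ j → g (unit j))

  sumAll-split : ∀ g → (∀ {x y} → x ≈ y → g x ≈ g y) → sumAll g ≈ g 0# + sumUnits g
  sumAll-split g g-cong = trans (sum-remove {i = zeroIndex} (g ∘ element)) (+-congʳ (g-cong (element-index 0#)))

  sumAll-reindex : ∀ g → (∀ {x y} → x ≈ y → g x ≈ g y) → ∀ {π} → (∀ {x y} → x ≈ y → π x ≈ π y) →
                   IsPermutation F π → sumAll (g ∘ π) ≈ sumAll g
  sumAll-reindex g g-cong π-cong (π-injective , π-surjective) =
    reindex +-commutativeMonoid everything g g-cong (record
      { cong = π-cong ; preserves = λ _ → _ ; injective = π-injective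
      ; surjective = λ y _ → proj₁ (π-surjective y) , _ , proj₂ (π-surjective y) })

  scaling-injective : ∀ {c} → ¬ c ≈ 0# → ∀ x y → c * x ≈ c * y → x ≈ y
  scaling-injective c≉0 _ _ = *-cancelˡ-nonzero c≉0

  scaling-preimage : ∀ {c} → ¬ c ≈ 0# → ∀ y → ∃ λ x → c * x ≈ y
  scaling-preimage {c} c≉0 y = c⁻¹ * y , (begin
    c * (c⁻¹ * y)  ≈⟨ *-assoc c c⁻¹ y ⟨
    (c * c⁻¹) * y  ≈⟨ *-congʳ (proj₂ (inverse c c≉0)) ⟩
    1# * y         ≈⟨ *-identityˡ y ⟩
    y              ∎)
    where c⁻¹ = proj₁ (inverse c c≉0)

  scaling-permutes-units : ∀ {c} → ¬ c ≈ 0# → Permutes (λ x → ¬ x ≈ 0#) (c *_)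
  scaling-permutes-units c≉0 = record
    { cong       = *-congˡ
    ; preserves  = *-nonzero c≉0
    ; injective  = scaling-injective c≉0
    ; surjective = λ y y≉0 → let x , cx≈y = scaling-preimage c≉0 y in
        x , (λ x≈0 → y≉0 (trans (sym cx≈y) (trans (*-congˡ x≈0) (zeroʳ _)))) , cx≈y }

  scaling-permutation : ∀ {c} → ¬ c ≈ 0# → IsPermutation F (c *_)
  scaling-permutation c≉0 = scaling-injective c≉0 , scaling-preimage c≉0

  -- The characteristic divides |F|: comparing ∑ x with ∑ (x + 1) gives |F|·1 = 0.
  card×1≈0 : suc N′ × 1# ≈ 0#
  card×1≈0 = identityʳ-unique (sumAll (λ x → x)) _ (begin
    sumAll (λ x → x) + suc N′ × 1#           ≈⟨ +-congˡ (sum-replicate (suc N′)) ⟨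
    sumAll (λ x → x) + sum {suc N′} (λ _ → 1#) ≈⟨ ∑-distrib-+ element (λ _ → 1#) ⟨
    sumAll (λ x → x + 1#)                    ≈⟨ sumAll-reindex (λ x → x) (λ x≈y → x≈y) +-congʳ shift ⟩
    sumAll (λ x → x)                         ∎)
    where
    shift : IsPermutation F (_+ 1#)
    shift = (λ x y → ∙-cancelʳ 1# x y)
          , (λ y → y + - 1# , trans (+-assoc y (- 1#) 1#) (trans (+-congˡ (-‿inverseˡ 1#)) (+-identityʳ y)))

  -- Fermat: x^N′ = 1 for x ≠ 0, since x·u ranges over all units u as u does.
  fermat : ∀ {x} → ¬ x ≈ 0# → x ^ N′ ≈ 1#
  fermat {x} x≉0 = *-cancelˡ-nonzero (product-nonzero unit (Enumeration.sound units)) (begin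
    ∏u * x ^ N′                     ≈⟨ *-comm ∏u (x ^ N′) ⟩
    x ^ N′ * ∏u                     ≈⟨ *-congʳ (Product.sum-replicate N′) ⟨
    Product.sum {N′} (λ _ → x) * ∏u ≈⟨ Product.∑-distrib-+ (λ _ → x) unit ⟨
    Product.sum (λ j → x * unit j)  ≈⟨ reindex *-commutativeMonoid units (λ y → y) (λ y≈z → y≈z)
                                                 (scaling-permutes-units x≉0) ⟩
    ∏u                              ≈⟨ *-identityʳ ∏u ⟨
    ∏u * 1#                         ∎)
    where ∏u = Product.sum unit

  fermat-multiple : ∀ {x} t → ¬ x ≈ 0# → x ^ (t ℕ.* N′) ≈ 1#
  fermat-multiple {x} t x≉0 = begin
    x ^ (t ℕ.* N′)  ≈⟨ reflexive (≡.cong (x ^_) (ℕ.*-comm t N′)) ⟩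
    x ^ (N′ ℕ.* t)  ≈⟨ ^-assocʳ x N′ t ⟨
    (x ^ N′) ^ t    ≈⟨ ^-congˡ t (fermat x≉0) ⟩
    1# ^ t          ≈⟨ 1^n≈1 t ⟩
    1#              ∎

  -- For 0 < k < N′ some unit is not a k-th root of unity: otherwise the N′ units
  -- would be distinct roots of the degree-k polynomial X^k - 1.
  non-root-of-unity : ∀ {k} → 0 < k → k < N′ → ∃ λ x → ¬ x ≈ 0# ∧ ¬ x ^ k ≈ 1#
  non-root-of-unity {suc k} _ k<N′ with any? (λ j → ¬? (unit j ^ suc k ≈? 1#))
  ... | yes (j , uⱼ^k≉1) = unit j , Enumeration.sound units j , uⱼ^k≉1
  ... | no  ¬∃ = contradiction too-many-roots (ℕ.<⇒≱ k<N′)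
    where
    all-roots : ∀ j → evalMonic (X^[1+k]-1 k) (unit j) ≈ 0#
    all-roots j = begin
      evalMonic (X^[1+k]-1 k) (unit j)  ≈⟨ evalMonic-X^[1+k]-1 k (unit j) ⟩
      - 1# + unit j ^ suc k             ≈⟨ +-congˡ (decidable-stable (_ ≈? 1#) λ ≉1 → ¬∃ (j , ≉1)) ⟩
      - 1# + 1#                         ≈⟨ -‿inverseˡ 1# ⟩
      0#                                ∎
    too-many-roots : N′ ≤ suc k
    too-many-roots = ≡.subst₂ _≤_ (length-tabulate unit) (≡.cong suc (length-replicate k))
      (root-bound (X^[1+k]-1 k) (tabulate unit)
        (AllPairsProperties.tabulate⁺ λ i≢j uᵢ≈uⱼ → i≢j (Enumeration.injective units _ _ uᵢ≈uⱼ))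
        (AllProperties.tabulate⁺ all-roots))

  powerSum : ℕ → Carrier
  powerSum m = sumAll (_^ m)

  powerSum-0 : powerSum 0 ≈ 0#
  powerSum-0 = trans (sum-replicate (suc N′)) card×1≈0

  -- If N′ ∤ m, pick w ≠ 0 with w^m ≠ 1 (w^m = w^(m mod N′)); the power sum is
  -- invariant under multiplication by w^m, hence zero.
  powerSum-nondivisible : ∀ m → .{{_ : ℕ.NonZero N′}} → ¬ N′ ∣ m → powerSum m ≈ 0#
  powerSum-nondivisible m N′∤m = fixed-by-non-one⇒0 w^m≉1 (begin
    w ^ m * powerSum m               ≈⟨ *-distribˡ-sum (w ^ m) (λ i → element i ^ m) ⟩
    sumAll (λ x → w ^ m * x ^ m)     ≈⟨ sum-cong-≋ (λ i → ^-distrib-* w (element i) m) ⟨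
    sumAll (λ x → (w * x) ^ m)       ≈⟨ sumAll-reindex (_^ m) (^-congˡ m) *-congˡ (scaling-permutation w≉0) ⟩
    powerSum m                       ∎)
    where
    k = m % N′
    k>0 : 0 < k
    k>0 = ℕ.n≢0⇒n>0 λ k≡0 → N′∤m (m%n≡0⇒n∣m m N′ k≡0)
    w = proj₁ (non-root-of-unity k>0 (m%n<n m N′))
    w≉0 = proj₁ (proj₂ (non-root-of-unity k>0 (m%n<n m N′)))
    w^m≉1 : ¬ w ^ m ≈ 1#
    w^m≉1 w^m≈1 = proj₂ (proj₂ (non-root-of-unity k>0 (m%n<n m N′))) (begin
      w ^ k                         ≈⟨ *-identityʳ (w ^ k) ⟨
      w ^ k * 1#                    ≈⟨ *-congˡ (fermat-multiple (m / N′) w≉0) ⟨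
      w ^ k * w ^ (m / N′ ℕ.* N′)   ≈⟨ ^-homo-* w k _ ⟨
      w ^ (k ℕ.+ m / N′ ℕ.* N′)     ≈⟨ reflexive (≡.cong (w ^_) (m≡m%n+[m/n]*n m N′)) ⟨
      w ^ m                         ≈⟨ w^m≈1 ⟩
      1#                            ∎)

  -- If N′ ∣ m > 0, then x^m = 1 for every unit and 0^m = 0, so the sum is N′·1 = -1.
  powerSum-divisible : ∀ m → 0 < m → N′ ∣ m → powerSum m ≈ - 1#
  powerSum-divisible m@(suc m′) _ (divides t m≡tN′) = inverseʳ-unique 1# (powerSum m) (begin
    1# + powerSum m                         ≈⟨ +-congˡ (sumAll-split (_^ m) (^-congˡ m)) ⟩
    1# + (0# ^ m + sumUnits (_^ m))         ≈⟨ +-congˡ (+-cong (zeroˡ _) (sum-cong-≋ unit^m≈1)) ⟩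
    1# + (0# + sum {N′} (λ _ → 1#))         ≈⟨ +-congˡ (+-identityˡ _) ⟩
    1# + sum {N′} (λ _ → 1#)                ≈⟨ +-congˡ (sum-replicate N′) ⟩
    suc N′ × 1#                             ≈⟨ card×1≈0 ⟩
    0#                                      ∎)
    where
    unit^m≈1 : ∀ j → unit j ^ m ≈ 1#
    unit^m≈1 j = trans (reflexive (≡.cong (unit j ^_) m≡tN′)) (fermat-multiple t (Enumeration.sound units j))

  -- If |F| = p^e then p·1 = 0: its e-th power is |F|·1 = 0, and F has no nilpotents.
  char-of-prime-power : ∀ {p} e → suc N′ ≡ p ℕ.^ e → p × 1# ≈ 0#
  char-of-prime-power {p} e N≡p^e = decidable-stable (p × 1# ≈? 0#) λ p≉0 → ^-nonzero e p≉0 (begin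
    (p × 1#) ^ e    ≈⟨ ×1-^ p e ⟨
    (p ℕ.^ e) × 1#  ≈⟨ reflexive (≡.cong (_× 1#) N≡p^e) ⟨
    suc N′ × 1#     ≈⟨ card×1≈0 ⟩
    0#              ∎)

  -- The sum T(c) = ∑_x G_m(x^R·c) of geometric sums G_m expands to ∑_{j<m} c^j·S(R·j);
  -- it vanishes when N′ ∤ R·j for 0 < j < m, since also S(0) = 0.
  geometric-powerSum-vanishes : ∀ R m c → .{{_ : ℕ.NonZero N′}} → (∀ j → 0 < j → j < m → ¬ N′ ∣ R ℕ.* j) →
    sumAll (λ x → geometricSum m (x ^ R * c)) ≈ 0#
  geometric-powerSum-vanishes R m c N′∤Rj = begin
    sumAll (λ x → geometricSum m (x ^ R * c))           ≈⟨ ∑-comm {suc N′} {m} (λ i j → (element i ^ R * c) ^ toℕ j) ⟩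
    sum {m} (λ j → sumAll (λ x → (x ^ R * c) ^ toℕ j)) ≈⟨ sum-cong-≋ {m} inner ⟩
    sum {m} (λ _ → 0#)                                  ≈⟨ sum-replicate-zero m ⟩
    0#                                                  ∎
    where
    powerSum-R*j : ∀ (j : Fin m) → powerSum (R ℕ.* toℕ j) ≈ 0#
    powerSum-R*j j with toℕ j in eq
    ... | zero  = trans (reflexive (≡.cong powerSum (ℕ.*-zeroʳ R))) powerSum-0
    ... | suc t = powerSum-nondivisible (R ℕ.* suc t) (N′∤Rj (suc t) (s≤s z≤n) (≡.subst (_< m) eq (toℕ<n j)))
    inner : ∀ j → sumAll (λ x → (x ^ R * c) ^ toℕ j) ≈ 0#
    inner j = begin
      sumAll (λ x → (x ^ R * c) ^ toℕ j)
        ≈⟨ sum-cong-≋ (λ i → trans (^-distrib-* _ c (toℕ j)) (*-congʳ (^-assocʳ (element i) R (toℕ j)))) ⟩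
      sumAll (λ x → x ^ (R ℕ.* toℕ j) * c ^ toℕ j)
        ≈⟨ *-distribʳ-sum (c ^ toℕ j) (λ i → element i ^ (R ℕ.* toℕ j)) ⟨
      powerSum (R ℕ.* toℕ j) * c ^ toℕ j          ≈⟨ *-congʳ (powerSum-R*j j) ⟩
      0# * c ^ toℕ j                              ≈⟨ zeroˡ _ ⟩
      0#                                          ∎

  -- If b ≠ 0 is not an R-th power, b^m = 1 and N′ ∣ R·m (R, m > 0), then T(b⁻¹) = 1:
  -- x = 0 contributes G_m(0) = 1, and each unit u contributes G_m(z) = 0, where
  -- z = u^R·b⁻¹ ≠ 1 satisfies z^m = 1.
  geometric-powerSum-one : ∀ {b} R m → 0 < R → 0 < m → (b≉0 : ¬ b ≈ 0#) → b ^ m ≈ 1# → N′ ∣ R ℕ.* m →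
    (∀ x → ¬ x ^ R ≈ b) → sumAll (λ x → geometricSum m (x ^ R * proj₁ (inverse b b≉0))) ≈ 1#
  geometric-powerSum-one {b} R m@(suc m′) 0<R _ b≉0 b^m≈1 (divides t Rm≡tN′) no-root = begin
    sumAll term                ≈⟨ sumAll-split term (λ x≈y → geometricSum-cong m (*-congʳ (^-congˡ R x≈y))) ⟩
    term 0# + sumUnits term    ≈⟨ +-cong term-0 (sum-cong-≋ term-unit) ⟩
    1# + sum {N′} (λ _ → 0#)   ≈⟨ +-congˡ (sum-replicate-zero N′) ⟩
    1# + 0#                    ≈⟨ +-identityʳ 1# ⟩
    1#                         ∎
    where
    b⁻¹ = proj₁ (inverse b b≉0)
    bb⁻¹≈1 : b * b⁻¹ ≈ 1#
    bb⁻¹≈1 = proj₂ (inverse b b≉0)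
    term : Carrier → Carrier
    term x = geometricSum m (x ^ R * b⁻¹)
    term-0 : term 0# ≈ 1#
    term-0 = trans (geometricSum-cong m (trans (*-congʳ (0^-positive 0<R)) (zeroˡ b⁻¹))) (geometricSum-at-0 m′)
    term-unit : ∀ j → term (unit j) ≈ 0#
    term-unit j = geometricSum-vanishes m z^m≈1 z≉1
      where
      u = unit j
      z^m≈1 : (u ^ R * b⁻¹) ^ m ≈ 1#
      z^m≈1 = begin
        (u ^ R * b⁻¹) ^ m          ≈⟨ ^-distrib-* (u ^ R) b⁻¹ m ⟩
        (u ^ R) ^ m * b⁻¹ ^ m      ≈⟨ *-congʳ (^-assocʳ u R m) ⟩
        u ^ (R ℕ.* m) * b⁻¹ ^ m    ≈⟨ *-congʳ (reflexive (≡.cong (u ^_) Rm≡tN′)) ⟩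
        u ^ (t ℕ.* N′) * b⁻¹ ^ m   ≈⟨ *-congʳ (fermat-multiple t (Enumeration.sound units j)) ⟩
        1# * b⁻¹ ^ m               ≈⟨ *-congʳ b^m≈1 ⟨
        b ^ m * b⁻¹ ^ m            ≈⟨ ^-distrib-* b b⁻¹ m ⟨
        (b * b⁻¹) ^ m              ≈⟨ ^-congˡ m bb⁻¹≈1 ⟩
        1# ^ m                     ≈⟨ 1^n≈1 m ⟩
        1#                         ∎
      z≉1 : ¬ u ^ R * b⁻¹ ≈ 1#
      z≉1 z≈1 = no-root u (begin
        u ^ R                 ≈⟨ *-identityʳ _ ⟨
        u ^ R * 1#            ≈⟨ *-congˡ (trans (*-comm b⁻¹ b) bb⁻¹≈1) ⟨
        u ^ R * (b⁻¹ * b)     ≈⟨ *-assoc _ _ _ ⟨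
        (u ^ R * b⁻¹) * b     ≈⟨ *-congʳ z≈1 ⟩
        1# * b                ≈⟨ *-identityˡ b ⟩
        b                     ∎)

  -- Let b ≠ 0 with b^m = 1, where N′ ∣ R·m but N′ ∤ R·j for 0 < j < m.  Then b is an
  -- R-th power, as otherwise T(b⁻¹) would be both 0 and 1.
  Rth-power-exists : ∀ {b} R m → .{{_ : ℕ.NonZero N′}} → 0 < R → 0 < m → ¬ b ≈ 0# → b ^ m ≈ 1# →
    N′ ∣ R ℕ.* m → (∀ j → 0 < j → j < m → ¬ N′ ∣ R ℕ.* j) → ∃ λ x → x ^ R ≈ b
  Rth-power-exists {b} R m 0<R 0<m b≉0 b^m≈1 N′∣Rm N′∤Rj with any? (λ i → element i ^ R ≈? b)
  ... | yes (i , xᵢ^R≈b) = element i , xᵢ^R≈b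
  ... | no  ¬∃ = ⊥-elim (1≉0 (trans
    (sym (geometric-powerSum-one R m 0<R 0<m b≉0 b^m≈1 N′∣Rm no-root))
    (geometric-powerSum-vanishes R m _ N′∤Rj)))
    where
    no-root : ∀ x → ¬ x ^ R ≈ b
    no-root x x^R≈b = ¬∃ (index x , trans (^-congˡ R (element-index x)) x^R≈b)

  binomial-powerSum : ∀ a E n →
    sumAll (λ x → (x ^ E + a * x) ^ n) ≈
    sum {suc n} (λ k → ((n C toℕ k) × a ^ (n ∸ toℕ k)) * powerSum (E ℕ.* toℕ k ℕ.+ (n ∸ toℕ k)))
  binomial-powerSum a E n = begin
    sumAll (λ x → (x ^ E + a * x) ^ n)
      ≈⟨ sum-cong-≋ (λ i → trans (Binomial.theorem n _ _) (sum-cong-≋ (expand-term (element i)))) ⟩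
    sumAll (λ x → sum {suc n} (λ k → coeff k * x ^ exponent k))
      ≈⟨ ∑-comm {suc N′} {suc n} (λ i k → coeff k * element i ^ exponent k) ⟩
    sum {suc n} (λ k → sumAll (λ x → coeff k * x ^ exponent k))
      ≈⟨ sum-cong-≋ {suc n} (λ k → *-distribˡ-sum (coeff k) (λ i → element i ^ exponent k)) ⟨
    sum {suc n} (λ k → coeff k * powerSum (exponent k)) ∎
    where
    coeff : Fin (suc n) → Carrier
    coeff k = (n C toℕ k) × a ^ (n ∸ toℕ k)
    exponent : Fin (suc n) → ℕ
    exponent k = E ℕ.* toℕ k ℕ.+ (n ∸ toℕ k)
    expand-term : ∀ x k → Binomial.binomialTerm (x ^ E) (a * x) n k ≈ coeff k * x ^ exponent k
    expand-term x k = begin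
      (n C t) × ((x ^ E) ^ t * (a * x) ^ (n ∸ t))   ≈⟨ ×-congʳ (n C t) (*-cong (^-assocʳ x E t) (^-distrib-* a x (n ∸ t))) ⟩
      (n C t) × (x ^ (E ℕ.* t) * (a ^ (n ∸ t) * x ^ (n ∸ t))) ≈⟨ ×-congʳ (n C t) (x∙yz≈y∙xz _ _ _) ⟩
      (n C t) × (a ^ (n ∸ t) * (x ^ (E ℕ.* t) * x ^ (n ∸ t))) ≈⟨ ×-congʳ (n C t) (*-congˡ (^-homo-* x (E ℕ.* t) (n ∸ t))) ⟨
      (n C t) × (a ^ (n ∸ t) * x ^ exponent k)      ≈⟨ ×-assoc-* (n C t) _ _ ⟨
      coeff k * x ^ exponent k                      ∎
      where t = toℕ k

-- The setting of the theorem with q = n + 1: F has q² = 1 + n(n+2) elements and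
-- f = aX + X^(rn+1) permutes F.
module PermutationPolynomial {c ℓ} (F : Field c ℓ) (n r : ℕ) .{{_ : NonZero n}} (2≤r : 2 ≤ r)
  (card : HasCardinality F (suc n ℕ.* suc n)) (a : Field.Carrier F) (a≉0 : ¬ Field._≈_ F a (Field.0# F))
  (f-permutes : IsPermutation F (polyF F a (suc n) r)) where

  open Field F
  open FieldProperties F
  open FiniteField F card
  open import Relation.Binary.Reasoning.Setoid setoid
  open SemiringMult semiring using (_×_; ×-congʳ; ×-assoc-*)
  open SemiringExp semiring using (^-congˡ; ^-homo-*)
  open SemiringSum semiring using (sum; sum-cong-≋)

  Q = suc (suc n)

  N′≡n*Q : n ℕ.+ n ℕ.* suc n ≡ n ℕ.* Q
  N′≡n*Q = reorder n
    where
    reorder : ∀ n → n ℕ.+ n ℕ.* suc n ≡ n ℕ.* suc (suc n)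
    reorder = solve-∀

  private instance
    N′-nonZero : NonZero (n ℕ.+ n ℕ.* suc n)
    N′-nonZero = ≡.subst NonZero (≡.sym N′≡n*Q) (ℕ.m*n≢0 n Q)
    gcd-nonZero : NonZero (gcd r Q)
    gcd-nonZero = ℕ.≢-nonZero (gcd[m,n]≢0 r Q (inj₂ λ ()))

  R = r ℕ.* n
  f = polyF F a (suc n) r

  0<R : 0 < R
  0<R = ℕ.>-nonZero⁻¹ R {{ℕ.m*n≢0 r n {{ℕ.>-nonZero (ℕ.<-trans (s≤s z≤n) 2≤r)}}}}

  -- R·j = n·(r·j); so N′ = n·Q divides R·j exactly when Q divides r·j.
  rearrange : ∀ j → R ℕ.* j ≡ n ℕ.* (r ℕ.* j)
  rearrange j = shuffle r n j
    where
    shuffle : ∀ r n j → r ℕ.* n ℕ.* j ≡ n ℕ.* (r ℕ.* j)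
    shuffle = solve-∀

  -- Claim 2: (-a)^m ≠ 1 for m = (q+1)/gcd(r,q+1).  Otherwise -a = x^R for some x
  -- (R = r(q-1)), and then f(x) = a·x - a·x = 0 = f(0) with x ≠ 0.
  minus-a-power : ¬ (- a) ^ quotGcd r (suc n) ≈ 1#
  minus-a-power [-a]^m≈1 = -‿nonzero a≉0 (begin
    - a        ≈⟨ x^R≈-a ⟨
    x ^ R      ≈⟨ ^-congˡ R x≈0 ⟩
    0# ^ R     ≈⟨ 0^-positive 0<R ⟩
    0#         ∎)
    where
    m = quotGcd r (suc n)
    N′∣Rm : n ℕ.+ n ℕ.* suc n ∣ R ℕ.* m
    N′∣Rm = ≡.subst₂ _∣_ (≡.sym N′≡n*Q) (≡.sym (rearrange m)) (*-monoʳ-∣ n (∣-r*quotient r Q))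
    N′∤Rj : ∀ j → 0 < j → j < m → ¬ n ℕ.+ n ℕ.* suc n ∣ R ℕ.* j
    N′∤Rj j 0<j j<m N′∣Rj = quotient-least r Q j 0<j j<m
      (*-cancelˡ-∣ n (≡.subst₂ _∣_ N′≡n*Q (rearrange j) N′∣Rj))
    root = Rth-power-exists R m 0<R (quotient-positive r Q) (-‿nonzero a≉0) [-a]^m≈1 N′∣Rm N′∤Rj
    x = proj₁ root
    x^R≈-a = proj₂ root
    fx≈0 : f x ≈ 0#
    fx≈0 = begin
      a * x + x ^ (R ℕ.+ 1)   ≈⟨ +-congˡ (^-homo-* x R 1) ⟩
      a * x + x ^ R * (x * 1#) ≈⟨ +-congˡ (*-cong x^R≈-a (*-identityʳ x)) ⟩
      a * x + - a * x         ≈⟨ distribʳ x a (- a) ⟨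
      (a + - a) * x           ≈⟨ *-congʳ (-‿inverseʳ a) ⟩
      0# * x                  ≈⟨ zeroˡ x ⟩
      0#                      ∎
    f0≈0 : f 0# ≈ 0#
    f0≈0 = trans (+-cong (zeroʳ a) (0^-positive (ℕ.m≤n+m 1 R))) (+-identityʳ 0#)
    x≈0 : x ≈ 0#
    x≈0 = proj₁ f-permutes x 0# (trans fx≈0 (sym f0≈0))

  f-cong : ∀ {x y} → x ≈ y → f x ≈ f y
  f-cong x≈y = +-cong (*-congˡ x≈y) (^-congˡ (R ℕ.+ 1) x≈y)

  -- The coefficient of X^(n(1 + k·r)) in f^n = (X^(R+1) + aX)^n.
  coeff : Fin (suc n) → Carrier
  coeff k = (n C toℕ k) × a ^ (n ∸ toℕ k)

  -- Since f permutes F, ∑_k coeff(k)·S(n(1 + k·r)) = ∑_x f(x)^n = S(n) = 0, as N′ ∤ n.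
  expansion : sum (λ k → coeff k * powerSum (n ℕ.* suc (toℕ k ℕ.* r))) ≈ 0#
  expansion = begin
    sum (λ k → coeff k * powerSum (n ℕ.* suc (toℕ k ℕ.* r)))
      ≈⟨ sum-cong-≋ {suc n} (λ k → *-congˡ {coeff k}
           (reflexive (≡.cong powerSum (binomial-exponent n r (toℕ k) (toℕ≤pred[n] k))))) ⟨
    sum {suc n} (λ k → coeff k * powerSum ((R ℕ.+ 1) ℕ.* toℕ k ℕ.+ (n ∸ toℕ k)))
      ≈⟨ binomial-powerSum a (R ℕ.+ 1) n ⟨
    sumAll (λ x → (x ^ (R ℕ.+ 1) + a * x) ^ n)
      ≈⟨ sum-cong-≋ (λ i → ^-congˡ n (+-comm (element i ^ (R ℕ.+ 1)) (a * element i))) ⟩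
    sumAll (λ x → f x ^ n)
      ≈⟨ sumAll-reindex (_^ n) (^-congˡ n) f-cong f-permutes ⟩
    powerSum n
      ≈⟨ powerSum-nondivisible n (>⇒∤ n<N′) ⟩
    0# ∎
    where n<N′ = ℕ.m<m+n n (ℕ.>-nonZero⁻¹ (n ℕ.* suc n) {{ℕ.m*n≢0 n (suc n)}})

  powerSum-exponent-divisible : ∀ j → Q ∣ suc (j ℕ.* r) → powerSum (n ℕ.* suc (j ℕ.* r)) ≈ - 1#
  powerSum-exponent-divisible j Q∣ = powerSum-divisible _ (ℕ.>-nonZero⁻¹ _ {{ℕ.m*n≢0 n (suc (j ℕ.* r))}})
    (≡.subst (_∣ n ℕ.* suc (j ℕ.* r)) (≡.sym N′≡n*Q) (*-monoʳ-∣ n Q∣))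

  powerSum-exponent-nondivisible : ∀ j → ¬ Q ∣ suc (j ℕ.* r) → powerSum (n ℕ.* suc (j ℕ.* r)) ≈ 0#
  powerSum-exponent-nondivisible j Q∤ = powerSum-nondivisible _ λ N′∣ →
    Q∤ (*-cancelˡ-∣ n (≡.subst (_∣ n ℕ.* suc (j ℕ.* r)) N′≡n*Q N′∣))

  -- Claim 1: gcd(r, q+1) ≠ 1 when q = p^e.  Otherwise let j₀ < q be the unique solution of
  -- 1 + j·r ≡ 0 (mod q+1); in the expansion only the term k = j₀ survives, so
  -- -coeff(j₀) = 0 and C(n, j₀)·1 = 0 in F.  But p = char F does not divide C(p^e - 1, j₀).
  r-not-coprime : ∀ {p e} → Prime p → suc n ≡ p ℕ.^ e → r ≤ suc n → ¬ Coprime r Q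
  r-not-coprime {p} {e} p-prime q≡p^e r≤q r⊥Q =
    coprime-to-char-nonzero p-prime p≈0 (prime-∤-C p-prime e n (toℕ k₀) (≡.sym q≡p^e) (toℕ≤pred[n] k₀)) C≈0
    where
    p≈0 : p × 1# ≈ 0#
    p≈0 = char-of-prime-power (e ℕ.+ e) (≡.trans (≡.cong₂ ℕ._*_ q≡p^e q≡p^e) (≡.sym (ℕ.^-distribˡ-+-* p e e)))

    solution = unique-solution 2≤r r≤q r⊥Q
    j₀<q = proj₁ (proj₂ solution)
    k₀ : Fin (suc n)
    k₀ = fromℕ< j₀<q
    Q∣k₀ : Q ∣ suc (toℕ k₀ ℕ.* r)
    Q∣k₀ = ≡.subst (λ j → Q ∣ suc (j ℕ.* r)) (≡.sym (toℕ-fromℕ< j₀<q)) (proj₁ (proj₂ (proj₂ solution)))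

    term : Fin (suc n) → Carrier
    term k = coeff k * powerSum (n ℕ.* suc (toℕ k ℕ.* r))

    others-vanish : ∀ k → k ≢ k₀ → term k ≈ 0#
    others-vanish k k≢k₀ = trans (*-congˡ (powerSum-exponent-nondivisible (toℕ k) λ Q∣ →
      k≢k₀ (toℕ-injective (≡.trans (proj₂ (proj₂ (proj₂ solution)) (toℕ k) (toℕ<n k) Q∣)
                                   (≡.sym (toℕ-fromℕ< j₀<q)))))) (zeroʳ _)

    coeff-k₀≈0 : coeff k₀ ≈ 0#
    coeff-k₀≈0 = no-zero-divisors (-‿nonzero 1≉0) (begin
      - 1# * coeff k₀   ≈⟨ *-comm _ _ ⟩
      coeff k₀ * - 1#   ≈⟨ *-congˡ (powerSum-exponent-divisible (toℕ k₀) Q∣k₀) ⟨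
      term k₀           ≈⟨ sum-single term k₀ others-vanish ⟨
      sum term          ≈⟨ expansion ⟩
      0#                ∎)

    C≈0 : (n C toℕ k₀) × 1# ≈ 0#
    C≈0 = no-zero-divisors (^-nonzero (n ∸ toℕ k₀) a≉0) (begin
      a ^ (n ∸ toℕ k₀) * ((n C toℕ k₀) × 1#)  ≈⟨ *-comm _ _ ⟩
      ((n C toℕ k₀) × 1#) * a ^ (n ∸ toℕ k₀)  ≈⟨ ×-assoc-* (n C toℕ k₀) 1# _ ⟩
      (n C toℕ k₀) × (1# * a ^ (n ∸ toℕ k₀))  ≈⟨ ×-congʳ (n C toℕ k₀) (*-identityˡ _) ⟩
      coeff k₀                                ≈⟨ coeff-k₀≈0 ⟩
      0#                                      ∎)

open import Data.Product using (_×_)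

theorem1p4 : ∀ {c ℓ} (F : Field c ℓ) (q r : ℕ) (a : Field.Carrier F) →
    IsPrimePower q → HasCardinality F (q ℕ.* q) →
    2 ≤ r → r ≤ q →
    ¬ (Field._≈_ F a (Field.0# F)) →
    IsPermutation F (polyF F a q r) →
    (1 < gcd r (ℕ.suc q)
      × ¬ (Field._≈_ F (Field._^_ F (Field.-_ F a) (quotGcd r q)) (Field.1# F)))
    × ((pr : Prime r) →
      (r ∣ ℕ.suc q)
      × ¬ (Field._≈_ F (Field._^_ F (Field.-_ F a) (quotPrime r q pr)) (Field.1# F)))
theorem1p4 F zero          r a _ _ 2≤r r≤0 _ _ = contradiction (ℕ.≤-trans 2≤r r≤0) λ ()
theorem1p4 F (suc zero)    r a _ _ 2≤r r≤1 _ _ = contradiction (ℕ.≤-trans 2≤r r≤1) λ { (s≤s ()) }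
theorem1p4 F (suc n@(suc _)) r a (p , e , p-prime , _ , q≡p^e) card 2≤r r≤q a≉0 f-permutes =
  (1<gcd , minus-a-power) ,
  λ r-prime → r∣Q r-prime , minus-a-power ∘ ≡.subst (λ m → (- a) ^ m ≈ 1#) (quotients-agree r-prime)
  where
  open Field F
  open PermutationPolynomial F n r 2≤r card a a≉0 f-permutes

  gcd≢0 : gcd r Q ≢ 0
  gcd≢0 = gcd[m,n]≢0 r Q (inj₂ λ ())

  1<gcd : 1 < gcd r Q
  1<gcd = ℕ.≤∧≢⇒< (ℕ.n≢0⇒n>0 gcd≢0) λ 1≡gcd →
    r-not-coprime {e = e} p-prime q≡p^e r≤q (gcd≡1⇒coprime (≡.sym 1≡gcd))

  gcd≡r : Prime r → gcd r Q ≡ r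
  gcd≡r r-prime with prime⇒irreducible r-prime (gcd[m,n]∣m r Q)
  ... | inj₁ gcd≡1 = contradiction gcd≡1 (ℕ.<⇒≢ 1<gcd ∘ ≡.sym)
  ... | inj₂ gcd≡r = gcd≡r

  r∣Q : Prime r → r ∣ Q
  r∣Q r-prime = ≡.subst (_∣ Q) (gcd≡r r-prime) (gcd[m,n]∣n r Q)

  quotients-agree : (r-prime : Prime r) → quotPrime r (suc n) r-prime ≡ quotGcd r (suc n)
  quotients-agree r-prime = /-congʳ {{prime⇒nonZero r-prime}} {{ℕ.≢-nonZero gcd≢0}} (≡.sym (gcd≡r r-prime))
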